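{- Let $G$ be a $5$-odd-connected graph, let $v$ be a vertex of degree six and let $v_1,\ldots,v_6$ be its neighbors. Then at least one of the graphs $G.v_1vv_2$, $G.v_2vv_3$ and $G.v_3vv_4$ is also $5$-odd-connected.
   Context: Graphs may have loops and parallel edges. For a partition $(A,B)$ of the vertex set, the edge-cut $E(A,B)$ is the set of edges with one end in $A$ and the other in $B$. A graph is $5$-odd-connected if it has no edge-cut of odd size less than $5$. Splitting: for a vertex $v$ and neighbors $v_1,v_2$ of $v$, the graph $G.v_1vv_2$ is obtained by removing the edges $vv_1$ and $vv_2$ and adding a new vertex joined by one edge to $v_1$ and one edge to $v_2$ (with the natural conventions for loops: if $vv_1$ is a loop, the loop is removed and $vv_2$ is subdivided, and symmetrically; if both are loops, they are removed and a new vertex joined to $v$ by two parallel edges is added). -}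

module Defs where

open import Data.Nat using (ℕ; suc; _≤_; _%_)
open import Data.Fin using (Fin; inject₁; fromℕ; _≟_)
open import Data.List using (List; []; _∷_; _++_; length; lookup; map; filterᵇ; allFin)
open import Data.Bool using (Bool; true; false; not; _xor_; _∧_)
open import Data.Product using (_×_; _,_; proj₁; proj₂)
open import Relation.Nullary.Decidable using (⌊_⌋)
open import Relation.Binary.PropositionalEquality using (_≡_)

-- A finite multigraph (loops and parallel edges allowed):
-- vertex set Fin n, edges given as a list of (unordered) pairs of ends.
record Graph : Set where
  constructor mkGraph
  field
    n     : ℕ
    edges : List (Fin n × Fin n)
open Graph public

Edge : Graph → Set
Edge G = Fin (length (edges G))

-- A half-edge (edge-end): an edge together with a choice of one of its two ends.
-- A loop at v contributes two half-edges at v (so counts 2 towards the degree).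
HalfEdge : Graph → Set
HalfEdge G = Edge G × Bool

end : (G : Graph) → Fin (n G) × Fin (n G) → Bool → Fin (n G)
end G (x , y) false = x
end G (x , y) true  = y

endpoint : (G : Graph) → HalfEdge G → Fin (n G)
endpoint G (e , b) = end G (lookup (edges G) e) b

otherEnd : (G : Graph) → HalfEdge G → Fin (n G)
otherEnd G (e , b) = end G (lookup (edges G) e) (not b)

cutSize : (G : Graph) → (Fin (n G) → Bool) → ℕ
cutSize G A = length (filterᵇ (λ xy → A (proj₁ xy) xor A (proj₂ xy)) (edges G))

FiveOddConnected : Graph → Set
FiveOddConnected G = (A : Fin (n G) → Bool) → cutSize G A % 2 ≡ 1 → 5 ≤ cutSize G A

-- Splitting G.v₁vv₂ along the two half-edges h₁, h₂ at v (edges vv₁ and vv₂):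
-- remove the edges of h₁ and h₂ (only once if they are the two ends of the same loop),
-- add a new vertex w (= fromℕ n, old vertices embedded by inject₁) joined by one edge
-- to the other end of h₁ and one edge to the other end of h₂.
split : (G : Graph) → HalfEdge G → HalfEdge G → Graph
split G (e₁ , b₁) (e₂ , b₂) =
  mkGraph (suc (n G))
    (map lift kept ++
      ((w , inject₁ (otherEnd G (e₁ , b₁))) ∷ (w , inject₁ (otherEnd G (e₂ , b₂))) ∷ []))
  where
  w : Fin (suc (n G))
  w = fromℕ (n G)
  lift : Fin (n G) × Fin (n G) → Fin (suc (n G)) × Fin (suc (n G))
  lift (x , y) = inject₁ x , inject₁ y
  keep : Edge G → Bool
  keep k = not ⌊ k ≟ e₁ ⌋ ∧ not ⌊ k ≟ e₂ ⌋
  kept : List (Fin (n G) × Fin (n G))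
  kept = map (lookup (edges G)) (filterᵇ keep (allFin (length (edges G))))

module Submission where

-- Call X tight (at v) if v ∉ X and the cut of X has exactly five edges.
-- (1) Comparing the cuts of G.v₁vv₂ and of G edge by edge (`split-balance`), a small odd
--     cut of G.v₁vv₂ yields a tight set containing v₁ and v₂ (`split-obstruction`).
-- (2) Tight sets X, Y containing a common neighbour o of v uncross: X ∪ Y is tight
--     (`uncross`), by submodularity and posimodularity of cuts and parity, the edge vo
--     being counted between X ∩ Y and the outside of X ∪ Y.
-- (3) No tight set contains the other ends of four half-edges at v: moving v into it
--     (`move-vertex`, with the degree counted through the enumeration h in
--     `enumeration-count`) would give an odd cut of size at most 3.
-- If all three splittings failed, (1) gives tight sets through v₁v₂, v₂v₃, v₃v₄, which
-- (2) merges into one through v₁, …, v₄, contradicting (3). Since 5-odd-connectivity is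
-- decidable, this yields the disjunction.

open import Defs
open import Data.Nat using (ℕ; zero; suc; _+_; _*_; _≤_; _<_; _%_; _≡ᵇ_; _<?_; z≤n; s≤s)
open import Data.Nat.Properties hiding (_≟_)
open import Data.Bool using (Bool; true; false; not; _∧_; _∨_; _xor_; T)
import Data.Bool.Properties as Bool
open import Data.Fin using (Fin; zero; suc; inject₁; fromℕ; _≟_; punchIn)
open import Data.Fin.Properties using (punchInᵢ≢i)
open import Data.List using (List; []; _∷_; _++_; length; lookup; map; filterᵇ; allFin; tabulate)
open import Data.List.Properties using (tabulate-lookup)
open import Data.Vec using () renaming (lookup to lookupᵥ; tabulate to tabulateᵥ)
open import Data.Vec.Properties using (lookup∘tabulate)
open import Data.Fin.Subset.Properties using (anySubset?)
open import Algebra.Properties.CommutativeSemigroup +-commutativeSemigroup using (xy∙z≈xz∙y)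
open import Data.Product using (Σ-syntax; ∃; _×_; _,_; proj₁; proj₂)
open import Data.Product.Properties using (≡-dec)
open import Data.Sum using (_⊎_; inj₁; inj₂)
open import Data.Empty using (⊥; ⊥-elim)
open import Relation.Nullary using (Dec; yes; no; does)
open import Relation.Nullary.Decidable using (⌊_⌋; dec-true; dec-false; _×-dec_)
open import Relation.Binary.PropositionalEquality
open import Function.Definitions using (Injective)
open import Algebra.Properties.Semiring.Sum +-*-semiring
  using (sum; sum-syntax; ∑-distrib-+; ∑-comm; sum-cong-≗; sum-remove; sum-replicate-zero; *-distribˡ-sum)

open ≡-Reasoning

𝟙 : Bool → ℕ
𝟙 true  = 1
𝟙 false = 0

record Both (P : Bool → Set) : Set where
  constructor both
  field
    at-false : P false
    at-true  : P true

by-cases : {P : Bool → Set} → Both P → ∀ b → P b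
by-cases c false = Both.at-false c
by-cases c true  = Both.at-true c

-- An identity between ℕ-valued functions of four Booleans follows from its sixteen
-- instances; these are closed terms, so the argument is found by evaluation (write _).
by-evaluation : {f g : Bool → Bool → Bool → Bool → ℕ} →
  Both (λ p → Both λ q → Both λ r → Both λ s → T (f p q r s ≡ᵇ g p q r s)) →
  ∀ p q r s → f p q r s ≡ g p q r s
by-evaluation checks p q r s =
  ≡ᵇ⇒≡ _ _ (by-cases (by-cases (by-cases (by-cases checks p) q) r) s)

odd : ℕ → Bool
odd zero          = false
odd (suc zero)    = true
odd (suc (suc n)) = odd n

odd-suc : ∀ n → odd (suc n) ≡ not (odd n)
odd-suc zero          = refl
odd-suc (suc zero)    = refl
odd-suc (suc (suc n)) = odd-suc n

odd-+ : ∀ m n → odd (m + n) ≡ odd m xor odd n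
odd-+ zero          n = refl
odd-+ (suc zero)    n = odd-suc n
odd-+ (suc (suc m)) n = odd-+ m n

odd-+-even : ∀ m k → odd (m + 2 * k) ≡ odd m
odd-+-even m k = begin
  odd (m + 2 * k)                    ≡⟨ odd-+ m (k + (k + 0)) ⟩
  odd m xor odd (k + (k + 0))        ≡⟨ cong (odd m xor_) (odd-+ k (k + 0)) ⟩
  odd m xor (odd k xor odd (k + 0))  ≡⟨ cong (λ j → odd m xor (odd k xor odd j)) (+-identityʳ k) ⟩
  odd m xor (odd k xor odd k)        ≡⟨ cong (odd m xor_) (Bool.xor-same (odd k)) ⟩
  odd m xor false                    ≡⟨ Bool.xor-identityʳ (odd m) ⟩
  odd m                              ∎

odd-summand : ∀ m n → odd n ≡ odd m xor odd (m + n)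
odd-summand m n = begin
  odd n                        ≡⟨ cong (_xor odd n) (Bool.xor-same (odd m)) ⟨
  (odd m xor odd m) xor odd n  ≡⟨ Bool.xor-assoc (odd m) (odd m) (odd n) ⟩
  odd m xor (odd m xor odd n)  ≡⟨ cong (odd m xor_) (odd-+ m n) ⟨
  odd m xor odd (m + n)        ∎

%2≡𝟙-odd : ∀ n → n % 2 ≡ 𝟙 (odd n)
%2≡𝟙-odd zero          = refl
%2≡𝟙-odd (suc zero)    = refl
%2≡𝟙-odd (suc (suc n)) = %2≡𝟙-odd n

%2≡1⇒odd : ∀ n → n % 2 ≡ 1 → odd n ≡ true
%2≡1⇒odd n eq with odd n | %2≡𝟙-odd n
... | true  | _  = refl
... | false | eq′ = ⊥-elim (0≢1+n (trans (sym eq′) eq))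

LargeIfOdd : ℕ → Set
LargeIfOdd c = odd c ≡ true → 5 ≤ c

large-if-odd : ∀ {G} → FiveOddConnected G → ∀ A → LargeIfOdd (cutSize G A)
large-if-odd {G} oc A odd-cut = oc A (trans (%2≡𝟙-odd (cutSize G A)) (cong 𝟙 odd-cut))

∑-single : ∀ {m} (f : Fin m → ℕ) (e : Fin m) → (∀ k → k ≢ e → f k ≡ 0) → sum f ≡ f e
∑-single {suc m} f e vanishes = begin
  sum f                              ≡⟨ sum-remove {i = e} f ⟩
  f e + sum (λ k → f (punchIn e k))  ≡⟨ cong (f e +_) rest ⟩
  f e + 0                            ≡⟨ +-identityʳ (f e) ⟩
  f e                                ∎
  where
  rest : sum (λ k → f (punchIn e k)) ≡ 0
  rest = trans (sum-cong-≗ (λ k → vanishes (punchIn e k) (punchInᵢ≢i e k))) (sum-replicate-zero m)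

term≤sum : ∀ {m} (f : Fin m → ℕ) (e : Fin m) → f e ≤ sum f
term≤sum {suc m} f e = ≤-trans (m≤m+n (f e) _) (≤-reflexive (sym (sum-remove {i = e} f)))

∑-point : ∀ {m} (e : Fin m) (b : Fin m → Bool) → ∑[ k < m ] 𝟙 (does (k ≟ e) ∧ b k) ≡ 𝟙 (b e)
∑-point e b = begin
  ∑[ k < _ ] 𝟙 (does (k ≟ e) ∧ b k)  ≡⟨ ∑-single _ e (λ k k≢e → cong (λ c → 𝟙 (c ∧ b k)) (dec-false (k ≟ e) k≢e)) ⟩
  𝟙 (does (e ≟ e) ∧ b e)             ≡⟨ cong (λ c → 𝟙 (c ∧ b e)) (dec-true (e ≟ e) refl) ⟩
  𝟙 (b e)                            ∎

∑-identity : ∀ {m} (a b c d t : Fin m → ℕ) → (∀ k → a k + b k ≡ c k + d k + 2 * t k) →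
  sum a + sum b ≡ sum c + sum d + 2 * sum t
∑-identity a b c d t termwise = begin
  sum a + sum b                                         ≡⟨ ∑-distrib-+ a b ⟨
  ∑[ k < _ ] (a k + b k)                                ≡⟨ sum-cong-≗ termwise ⟩
  ∑[ k < _ ] (c k + d k + 2 * t k)                      ≡⟨ ∑-distrib-+ (λ k → c k + d k) (λ k → 2 * t k) ⟩
  ∑[ k < _ ] (c k + d k) + ∑[ k < _ ] (2 * t k)         ≡⟨ cong₂ _+_ (∑-distrib-+ c d) (sym (*-distribˡ-sum 2 t)) ⟩
  sum c + sum d + 2 * sum t                             ∎

count : {A : Set} → (A → Bool) → List A → ℕ
count p xs = length (filterᵇ p xs)

count-∷ : {A : Set} (p : A → Bool) (x : A) (xs : List A) → count p (x ∷ xs) ≡ 𝟙 (p x) + count p xs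
count-∷ p x xs with p x
... | true  = refl
... | false = refl

count-++ : {A : Set} (p : A → Bool) (xs ys : List A) → count p (xs ++ ys) ≡ count p xs + count p ys
count-++ p []       ys = refl
count-++ p (x ∷ xs) ys = begin
  count p (x ∷ xs ++ ys)             ≡⟨ count-∷ p x (xs ++ ys) ⟩
  𝟙 (p x) + count p (xs ++ ys)       ≡⟨ cong (𝟙 (p x) +_) (count-++ p xs ys) ⟩
  𝟙 (p x) + (count p xs + count p ys) ≡⟨ +-assoc (𝟙 (p x)) _ _ ⟨
  𝟙 (p x) + count p xs + count p ys   ≡⟨ cong (_+ count p ys) (count-∷ p x xs) ⟨
  count p (x ∷ xs) + count p ys       ∎

count-map : {A B : Set} (p : B → Bool) (f : A → B) (xs : List A) → count p (map f xs) ≡ count (λ x → p (f x)) xs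
count-map p f []       = refl
count-map p f (x ∷ xs) = begin
  count p (f x ∷ map f xs)              ≡⟨ count-∷ p (f x) (map f xs) ⟩
  𝟙 (p (f x)) + count p (map f xs)      ≡⟨ cong (𝟙 (p (f x)) +_) (count-map p f xs) ⟩
  𝟙 (p (f x)) + count (λ y → p (f y)) xs ≡⟨ count-∷ (λ y → p (f y)) x xs ⟨
  count (λ y → p (f y)) (x ∷ xs)        ∎

count-filter : {A : Set} (p q : A → Bool) (xs : List A) → count p (filterᵇ q xs) ≡ count (λ x → q x ∧ p x) xs
count-filter p q []       = refl
count-filter p q (x ∷ xs) = begin
  count p (filterᵇ q (x ∷ xs))               ≡⟨ head-step (q x) refl ⟩
  𝟙 (q x ∧ p x) + count p (filterᵇ q xs)     ≡⟨ cong (𝟙 (q x ∧ p x) +_) (count-filter p q xs) ⟩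
  𝟙 (q x ∧ p x) + count (λ y → q y ∧ p y) xs ≡⟨ count-∷ (λ y → q y ∧ p y) x xs ⟨
  count (λ y → q y ∧ p y) (x ∷ xs)           ∎
  where
  head-step : ∀ b → q x ≡ b → count p (filterᵇ q (x ∷ xs)) ≡ 𝟙 (q x ∧ p x) + count p (filterᵇ q xs)
  head-step true  qx rewrite qx = count-∷ p x (filterᵇ q xs)
  head-step false qx rewrite qx = refl

count-tabulate : {A : Set} {m : ℕ} (p : A → Bool) (f : Fin m → A) → count p (tabulate f) ≡ ∑[ k < m ] 𝟙 (p (f k))
count-tabulate {m = zero}  p f = refl
count-tabulate {m = suc m} p f = trans (count-∷ p (f zero) _) (cong (𝟙 (p (f zero)) +_) (count-tabulate p (λ k → f (suc k))))

count-lookup : {A : Set} (p : A → Bool) (xs : List A) → count p xs ≡ ∑[ k < length xs ] 𝟙 (p (lookup xs k))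
count-lookup p xs = trans (cong (count p) (sym (tabulate-lookup xs))) (count-tabulate p (lookup xs))

_∩_ _∪_ _∖_ : {V : Set} → (V → Bool) → (V → Bool) → V → Bool
(X ∩ Y) z = X z ∧ Y z
(X ∪ Y) z = X z ∨ Y z
(X ∖ Y) z = X z ∧ not (Y z)

∅ : {V : Set} → V → Bool
∅ z = false

∁ : {V : Set} → (V → Bool) → V → Bool
∁ X z = not (X z)

crosses : {V : Set} → (V → Bool) → V × V → Bool
crosses A (x , y) = A x xor A y

joins : {V : Set} → (V → Bool) → (V → Bool) → V × V → Bool
joins P Q (x , y) = (P x ∧ Q y) ∨ (P y ∧ Q x)

edge : (G : Graph) → Edge G → Fin (n G) × Fin (n G)
edge G = lookup (edges G)

edgesWith : (G : Graph) → (Fin (n G) × Fin (n G) → Bool) → ℕ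
edgesWith G E = ∑[ k < length (edges G) ] 𝟙 (E (edge G k))

cut-as-sum : (G : Graph) (A : Fin (n G) → Bool) → cutSize G A ≡ edgesWith G (crosses A)
cut-as-sum G A = count-lookup (crosses A) (edges G)

cut-cong : (G : Graph) {A B : Fin (n G) → Bool} → (∀ z → A z ≡ B z) → cutSize G A ≡ cutSize G B
cut-cong G {A} {B} A≗B = begin
  cutSize G A            ≡⟨ cut-as-sum G A ⟩
  edgesWith G (crosses A) ≡⟨ sum-cong-≗ (λ k → cong 𝟙 (cong₂ _xor_ (A≗B (proj₁ (edge G k))) (A≗B (proj₂ (edge G k))))) ⟩
  edgesWith G (crosses B) ≡⟨ cut-as-sum G B ⟨
  cutSize G B            ∎

cut-∅ : (G : Graph) → cutSize G ∅ ≡ 0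
cut-∅ G = trans (cut-as-sum G ∅) (sum-replicate-zero (length (edges G)))

cut-∁ : (G : Graph) (A : Fin (n G) → Bool) → cutSize G (∁ A) ≡ cutSize G A
cut-∁ G A = begin
  cutSize G (∁ A)             ≡⟨ cut-as-sum G (∁ A) ⟩
  edgesWith G (crosses (∁ A)) ≡⟨ sum-cong-≗ (λ k → cong 𝟙 (Bool.xor-annihilates-not (A (proj₁ (edge G k))) (A (proj₂ (edge G k))))) ⟩
  edgesWith G (crosses A)     ≡⟨ cut-as-sum G A ⟨
  cutSize G A                 ∎

cut-identity : (G : Graph) (A B C D : Fin (n G) → Bool) (E : Fin (n G) × Fin (n G) → Bool) →
  (∀ e → 𝟙 (crosses A e) + 𝟙 (crosses B e) ≡ 𝟙 (crosses C e) + 𝟙 (crosses D e) + 2 * 𝟙 (E e)) →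
  cutSize G A + cutSize G B ≡ cutSize G C + cutSize G D + 2 * edgesWith G E
cut-identity G A B C D E edgewise = begin
  cutSize G A + cutSize G B
    ≡⟨ cong₂ _+_ (cut-as-sum G A) (cut-as-sum G B) ⟩
  edgesWith G (crosses A) + edgesWith G (crosses B)
    ≡⟨ ∑-identity _ _ _ _ _ (λ k → edgewise (edge G k)) ⟩
  edgesWith G (crosses C) + edgesWith G (crosses D) + 2 * edgesWith G E
    ≡⟨ cong (_+ 2 * edgesWith G E) (cong₂ _+_ (cut-as-sum G C) (cut-as-sum G D)) ⟨
  cutSize G C + cutSize G D + 2 * edgesWith G E
    ∎

submodular : (G : Graph) (X Y : Fin (n G) → Bool) →
  cutSize G X + cutSize G Y ≡ cutSize G (X ∩ Y) + cutSize G (X ∪ Y) + 2 * edgesWith G (joins (X ∖ Y) (Y ∖ X))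
submodular G X Y = cut-identity G X Y (X ∩ Y) (X ∪ Y) (joins (X ∖ Y) (Y ∖ X)) (λ (x , y) → edgewise (X x) (Y x) (X y) (Y y))
  where
  edgewise : ∀ p q r s → 𝟙 (p xor r) + 𝟙 (q xor s) ≡
    𝟙 ((p ∧ q) xor (r ∧ s)) + 𝟙 ((p ∨ q) xor (r ∨ s)) + 2 * 𝟙 (((p ∧ not q) ∧ (s ∧ not r)) ∨ ((r ∧ not s) ∧ (q ∧ not p)))
  edgewise = by-evaluation _

posimodular : (G : Graph) (X Y : Fin (n G) → Bool) →
  cutSize G X + cutSize G Y ≡ cutSize G (X ∖ Y) + cutSize G (Y ∖ X) + 2 * edgesWith G (joins (X ∩ Y) (∁ (X ∪ Y)))
posimodular G X Y = cut-identity G X Y (X ∖ Y) (Y ∖ X) (joins (X ∩ Y) (∁ (X ∪ Y))) (λ (x , y) → edgewise (X x) (Y x) (X y) (Y y))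
  where
  edgewise : ∀ p q r s → 𝟙 (p xor r) + 𝟙 (q xor s) ≡
    𝟙 ((p ∧ not q) xor (r ∧ not s)) + 𝟙 ((q ∧ not p) xor (s ∧ not r)) + 2 * 𝟙 (((p ∧ q) ∧ not (r ∨ s)) ∨ ((r ∧ s) ∧ not (p ∨ q)))
  edgewise = by-evaluation _

cut-partition : (G : Graph) (X Y : Fin (n G) → Bool) →
  cutSize G (X ∩ Y) + cutSize G (X ∖ Y) ≡ cutSize G X + 2 * edgesWith G (joins (X ∩ Y) (X ∖ Y))
cut-partition G X Y = begin
  cutSize G (X ∩ Y) + cutSize G (X ∖ Y)     ≡⟨ cut-identity G (X ∩ Y) (X ∖ Y) X ∅ (joins (X ∩ Y) (X ∖ Y)) (λ (x , y) → edgewise (X x) (Y x) (X y) (Y y)) ⟩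
  cutSize G X + cutSize G ∅ + 2 * e         ≡⟨ cong (λ c → cutSize G X + c + 2 * e) (cut-∅ G) ⟩
  cutSize G X + 0 + 2 * e                   ≡⟨ cong (_+ 2 * e) (+-identityʳ (cutSize G X)) ⟩
  cutSize G X + 2 * e                       ∎
  where
  e = edgesWith G (joins (X ∩ Y) (X ∖ Y))
  edgewise : ∀ p q r s → 𝟙 ((p ∧ q) xor (r ∧ s)) + 𝟙 ((p ∧ not q) xor (r ∧ not s)) ≡
    𝟙 (p xor r) + 0 + 2 * 𝟙 (((p ∧ q) ∧ (r ∧ not s)) ∨ ((r ∧ s) ∧ (p ∧ not q)))
  edgewise = by-evaluation _

at-half-edge : (G : Graph) (E : Fin (n G) × Fin (n G) → Bool) → (∀ x y → E (x , y) ≡ E (y , x)) →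
  (he : HalfEdge G) → E (edge G (proj₁ he)) ≡ E (endpoint G he , otherEnd G he)
at-half-edge G E E-sym (k , false) = refl
at-half-edge G E E-sym (k , true)  = E-sym _ _

crosses-sym : {V : Set} (A : V → Bool) (x y : V) → crosses A (x , y) ≡ crosses A (y , x)
crosses-sym A x y = Bool.xor-comm (A x) (A y)

joins-sym : {V : Set} {P Q : V → Bool} (x y : V) → joins P Q (x , y) ≡ joins P Q (y , x)
joins-sym {P = P} {Q} x y = Bool.∨-comm (P x ∧ Q y) (P y ∧ Q x)

joins-out-in : {V : Set} {X Y : V → Bool} {x y : V} → X x ≡ false → Y x ≡ false → X y ≡ true → Y y ≡ true →
  joins (X ∩ Y) (∁ (X ∪ Y)) (x , y) ≡ true
joins-out-in Xx Yx Xy Yy rewrite Xx | Yx | Xy | Yy = refl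

record Tight (G : Graph) (v : Fin (n G)) (X : Fin (n G) → Bool) : Set where
  field
    cut-five : cutSize G X ≡ 5
    avoids   : X v ≡ false

-- The arithmetic of uncrossing, for a = d(X ∩ Y), b = d(X ∪ Y), c = d(X ∖ Y), d = d(Y ∖ X):
-- if a is odd then b has the parity of a and b ≤ 10 - a ≤ 5; if a is even then c and d are
-- odd, hence c + d ≥ 10, which the edge counted by t forbids.
uncross-arith : ∀ {a b c d s t u u′} → LargeIfOdd a → LargeIfOdd b → LargeIfOdd c → LargeIfOdd d →
  5 + 5 ≡ a + b + 2 * s → 5 + 5 ≡ c + d + 2 * t → 1 ≤ t → a + c ≡ 5 + 2 * u → a + d ≡ 5 + 2 * u′ → b ≡ 5
uncross-arith {a} {b} {c} {d} {s} {t} {u} {u′} large-a large-b large-c large-d sub posi t≥1 part-c part-d =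
  by-parity-of-a (odd a) refl
  where
  odd-b : odd b ≡ odd a xor false
  odd-b = trans (odd-summand a b) (cong (odd a xor_) (trans (sym (odd-+-even (a + b) s)) (cong odd (sym sub))))
  odd-partner : ∀ e w → a + e ≡ 5 + 2 * w → odd e ≡ odd a xor true
  odd-partner e w part = trans (odd-summand a e) (cong (odd a xor_) (trans (cong odd part) (odd-+-even 5 w)))
  by-parity-of-a : ∀ p → odd a ≡ p → b ≡ 5
  -- a odd: 5 + b ≤ a + b ≤ a + b + 2s = 10 and b is odd
  by-parity-of-a true odd-a = ≤-antisym b≤5 (large-b (trans odd-b (cong (_xor false) odd-a)))
    where
    b≤5 : b ≤ 5
    b≤5 = +-cancelˡ-≤ 5 b 5
      (≤-trans (+-monoˡ-≤ b (large-a odd-a)) (≤-trans (m≤m+n (a + b) (2 * s)) (≤-reflexive (sym sub))))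
  -- a even: c and d are odd, so 10 ≤ c + d < c + d + 2t = 10
  by-parity-of-a false odd-a = ⊥-elim (<⇒≱ c+d<10 (+-mono-≤ (large-c (odd-c)) (large-d odd-d)))
    where
    odd-c : odd c ≡ true
    odd-c = trans (odd-partner c u part-c) (cong (_xor true) odd-a)
    odd-d : odd d ≡ true
    odd-d = trans (odd-partner d u′ part-d) (cong (_xor true) odd-a)
    c+d<10 : c + d < 10
    c+d<10 = <-≤-trans (m<m+n (c + d) (≤-trans (s≤s z≤n) (*-monoʳ-≤ 2 t≥1))) (≤-reflexive (sym posi))

-- Two tight sets through a common neighbour o of v uncross: their union is tight.
-- The edge vo joins X ∩ Y to the complement of X ∪ Y, so it is counted by posimodularity.
uncross : ∀ {G : Graph} {v : Fin (n G)} {X Y : Fin (n G) → Bool} → FiveOddConnected G →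
  (vo : HalfEdge G) → endpoint G vo ≡ v → Tight G v X → Tight G v Y →
  X (otherEnd G vo) ≡ true → Y (otherEnd G vo) ≡ true → Tight G v (X ∪ Y)
uncross {G} {v} {X} {Y} oc vo refl tight-X tight-Y X-o Y-o = record
  { cut-five = uncross-arith {s = e (joins (X ∖ Y) (Y ∖ X))} {t = e (joins (X ∩ Y) (∁ (X ∪ Y)))}
      {u = e (joins (X ∩ Y) (X ∖ Y))} {u′ = e (joins (Y ∩ X) (Y ∖ X))}
      (large (X ∩ Y)) (large (X ∪ Y)) (large (X ∖ Y)) (large (Y ∖ X))
      (trans (cong₂ _+_ (sym X.cut-five) (sym Y.cut-five)) (submodular G X Y))
      (trans (cong₂ _+_ (sym X.cut-five) (sym Y.cut-five)) (posimodular G X Y))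
      (≤-trans vo-counted (term≤sum _ (proj₁ vo)))
      (trans (cut-partition G X Y) (cong (_+ 2 * e (joins (X ∩ Y) (X ∖ Y))) X.cut-five))
      (trans (cong (_+ cutSize G (Y ∖ X)) (cut-cong G (λ z → Bool.∧-comm (X z) (Y z))))
             (trans (cut-partition G Y X) (cong (_+ 2 * e (joins (Y ∩ X) (Y ∖ X))) Y.cut-five)))
  ; avoids = cong₂ _∨_ X.avoids Y.avoids
  }
  where
  module X = Tight tight-X
  module Y = Tight tight-Y
  e : (Fin (n G) × Fin (n G) → Bool) → ℕ
  e = edgesWith G
  large : ∀ A → LargeIfOdd (cutSize G A)
  large = large-if-odd {G} oc
  vo-counted : 1 ≤ 𝟙 (joins (X ∩ Y) (∁ (X ∪ Y)) (edge G (proj₁ vo)))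
  vo-counted = subst (λ b → 1 ≤ 𝟙 b)
    (sym (trans (at-half-edge G (joins (X ∩ Y) (∁ (X ∪ Y))) (joins-sym {P = X ∩ Y} {Q = ∁ (X ∪ Y)}) vo)
                (joins-out-in {X = X} {Y = Y} X.avoids Y.avoids X-o Y-o)))
    ≤-refl

_≟ₕ_ : ∀ {m} (x y : Fin m × Bool) → Dec (x ≡ y)
_≟ₕ_ = ≡-dec _≟_ Bool._≟_

halfEdgesWith : (G : Graph) → (HalfEdge G → Bool) → ℕ
halfEdgesWith G φ = ∑[ k < length (edges G) ] (𝟙 (φ (k , false)) + 𝟙 (φ (k , true)))

halfEdges-point : (G : Graph) (y : HalfEdge G) (φ : HalfEdge G → Bool) →
  halfEdgesWith G (λ x → does (x ≟ₕ y) ∧ φ x) ≡ 𝟙 (φ y)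
halfEdges-point G (e , b) φ = trans (∑-single _ e off-e) (at-e b)
  where
  off-e : ∀ k → k ≢ e →
    𝟙 (does ((k , false) ≟ₕ (e , b)) ∧ φ (k , false)) + 𝟙 (does ((k , true) ≟ₕ (e , b)) ∧ φ (k , true)) ≡ 0
  off-e k k≢e rewrite dec-false ((k , false) ≟ₕ (e , b)) (λ eq → k≢e (cong proj₁ eq))
                    | dec-false ((k , true) ≟ₕ (e , b)) (λ eq → k≢e (cong proj₁ eq)) = refl
  at-e : ∀ b → 𝟙 (does ((e , false) ≟ₕ (e , b)) ∧ φ (e , false)) + 𝟙 (does ((e , true) ≟ₕ (e , b)) ∧ φ (e , true))
               ≡ 𝟙 (φ (e , b))
  at-e false rewrite dec-true ((e , false) ≟ₕ (e , false)) refl | dec-false ((e , true) ≟ₕ (e , false)) (λ ())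
    = +-identityʳ _
  at-e true rewrite dec-false ((e , false) ≟ₕ (e , true)) (λ ()) | dec-true ((e , true) ≟ₕ (e , true)) refl
    = refl

record Enumerates (G : Graph) (v : Fin (n G)) {d : ℕ} (h : Fin d → HalfEdge G) : Set where
  field
    injective : Injective _≡_ _≡_ h
    at-v      : ∀ i → endpoint G (h i) ≡ v
    complete  : ∀ x → endpoint G x ≡ v → ∃ λ i → h i ≡ x

at : (G : Graph) → Fin (n G) → HalfEdge G → Bool
at G v x = does (endpoint G x ≟ v)

-- Counting half-edges at v with property φ along an enumeration of them: each indicator
-- [x at v] is rewritten as ∑ᵢ [x = h i], and the double sum is exchanged.
enumeration-count : ∀ {G v d} {h : Fin d → HalfEdge G} → Enumerates G v h → (φ : HalfEdge G → Bool) →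
  halfEdgesWith G (λ x → at G v x ∧ φ x) ≡ ∑[ i < d ] 𝟙 (φ (h i))
enumeration-count {G} {v} {d} {h} enum φ = begin
  halfEdgesWith G (λ x → at G v x ∧ φ x)
    ≡⟨ sum-cong-≗ (λ k → cong₂ _+_ (at-v-as-sum (k , false)) (at-v-as-sum (k , true))) ⟩
  ∑[ k < m ] (∑[ i < d ] δ i (k , false) + ∑[ i < d ] δ i (k , true))
    ≡⟨ sum-cong-≗ (λ k → ∑-distrib-+ (λ i → δ i (k , false)) (λ i → δ i (k , true))) ⟨
  ∑[ k < m ] ∑[ i < d ] (δ i (k , false) + δ i (k , true))
    ≡⟨ ∑-comm (λ k i → δ i (k , false) + δ i (k , true)) ⟩
  ∑[ i < d ] halfEdgesWith G (λ x → does (x ≟ₕ h i) ∧ φ x)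
    ≡⟨ sum-cong-≗ (λ i → halfEdges-point G (h i) φ) ⟩
  ∑[ i < d ] 𝟙 (φ (h i))
    ∎
  where
  open Enumerates enum
  m = length (edges G)
  δ : Fin d → HalfEdge G → ℕ
  δ i x = 𝟙 (does (x ≟ₕ h i) ∧ φ x)
  δ-off : ∀ {x j} → x ≢ h j → δ j x ≡ 0
  δ-off {x} {j} x≢hj = cong (λ c → 𝟙 (c ∧ φ x)) (dec-false (x ≟ₕ h j) x≢hj)
  at-v-as-sum : ∀ x → 𝟙 (does (endpoint G x ≟ v) ∧ φ x) ≡ ∑[ i < d ] δ i x
  at-v-as-sum x with endpoint G x ≟ v
  ... | yes x-at-v with complete x x-at-v
  ...   | i , hi≡x = sym (begin
    ∑[ j < d ] δ j x     ≡⟨ ∑-single (λ j → δ j x) i (λ j j≢i → δ-off (λ x≡hj → j≢i (injective (trans (sym x≡hj) (sym hi≡x))))) ⟩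
    δ i x                ≡⟨ cong (λ c → 𝟙 (c ∧ φ x)) (dec-true (x ≟ₕ h i) (sym hi≡x)) ⟩
    𝟙 (true ∧ φ x)       ∎)
  at-v-as-sum x | no x-not-at-v = sym (trans
    (sum-cong-≗ (λ j → δ-off (λ x≡hj → x-not-at-v (trans (cong (endpoint G) x≡hj) (at-v j)))))
    (sum-replicate-zero d))

｛_｝ : ∀ {N} → Fin N → Fin N → Bool
｛ v ｝ z = does (z ≟ v)

loopAt : ∀ {N} → Fin N → Fin N × Fin N → Bool
loopAt v (x , y) = ｛ v ｝ x ∧ ｛ v ｝ y

-- Moving v into U: each half-edge at v adds a crossing edge, except that an edge into
-- U ∖ {v} stops crossing and a loop never crosses (both count 2 less), whence
--   d(U ∖ {v}) + deg v = d(U ∪ {v}) + 2 (#half-edges from v into U ∖ {v} + #loops at v).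
move-vertex : (G : Graph) (v : Fin (n G)) (U : Fin (n G) → Bool) →
  cutSize G (U ∖ ｛ v ｝) + halfEdgesWith G (λ x → at G v x ∧ true) ≡
  cutSize G (U ∪ ｛ v ｝) + 2 * (halfEdgesWith G (λ x → at G v x ∧ (U ∖ ｛ v ｝) (otherEnd G x)) + edgesWith G (loopAt v))
move-vertex G v U = begin
  cutSize G (U ∖ ｛ v ｝) + degree
    ≡⟨ cong (_+ degree) (cut-as-sum G (U ∖ ｛ v ｝)) ⟩
  edgesWith G (crosses (U ∖ ｛ v ｝)) + degree
    ≡⟨ ∑-identity (λ k → 𝟙 (crosses (U ∖ ｛ v ｝) (edge G k))) (λ k → 𝟙 (at G v (k , false) ∧ true) + 𝟙 (at G v (k , true) ∧ true))
                   (λ k → 𝟙 (crosses (U ∪ ｛ v ｝) (edge G k))) (λ _ → 0) (λ k → into-U k + loop k)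
                   (λ k → edgewise (U (x k)) (U (y k)) (｛ v ｝ (x k)) (｛ v ｝ (y k))) ⟩
  edgesWith G (crosses (U ∪ ｛ v ｝)) + ∑[ k < m ] 0 + 2 * ∑[ k < m ] (into-U k + loop k)
    ≡⟨ cong₂ (λ c z → c + z + 2 * ∑[ k < m ] (into-U k + loop k)) (sym (cut-as-sum G (U ∪ ｛ v ｝))) (sum-replicate-zero m) ⟩
  cutSize G (U ∪ ｛ v ｝) + 0 + 2 * ∑[ k < m ] (into-U k + loop k)
    ≡⟨ cong₂ (λ c z → c + 2 * z) (+-identityʳ (cutSize G (U ∪ ｛ v ｝))) (∑-distrib-+ into-U loop) ⟩
  cutSize G (U ∪ ｛ v ｝) + 2 * (sum into-U + sum loop)
    ∎
  where
  m = length (edges G)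
  x y : Fin m → Fin (n G)
  x k = proj₁ (edge G k)
  y k = proj₂ (edge G k)
  degree = halfEdgesWith G (λ h → at G v h ∧ true)
  into-U loop : Fin m → ℕ
  into-U k = 𝟙 (｛ v ｝ (x k) ∧ (U ∖ ｛ v ｝) (y k)) + 𝟙 (｛ v ｝ (y k) ∧ (U ∖ ｛ v ｝) (x k))
  loop k = 𝟙 (loopAt v (edge G k))
  edgewise : ∀ ux uy ex ey →
    𝟙 ((ux ∧ not ex) xor (uy ∧ not ey)) + (𝟙 (ex ∧ true) + 𝟙 (ey ∧ true)) ≡
    𝟙 ((ux ∨ ex) xor (uy ∨ ey)) + 0 + 2 * (𝟙 (ex ∧ (uy ∧ not ey)) + 𝟙 (ey ∧ (ux ∧ not ex)) + 𝟙 (ex ∧ ey))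
  edgewise = by-evaluation _

∖-avoided : ∀ {N} {U : Fin N → Bool} {v : Fin N} → U v ≡ false → ∀ z → (U ∖ ｛ v ｝) z ≡ U z
∖-avoided {U = U} {v} Uv z with z ≟ v
... | yes refl = trans (Bool.∧-zeroʳ (U z)) (sym Uv)
... | no _     = Bool.∧-identityʳ (U z)

four-ones : ∀ {a b c d} r → a ≡ true → b ≡ true → c ≡ true → d ≡ true → 4 ≤ 𝟙 a + (𝟙 b + (𝟙 c + (𝟙 d + r)))
four-ones r refl refl refl refl = s≤s (s≤s (s≤s (s≤s z≤n)))

cover-arith : ∀ c S L → 5 + 6 ≡ c + 2 * (S + L) → 4 ≤ S → odd c ≡ true × c < 5
cover-arith c S L eq S≥4 = odd-c , c<5
  where
  odd-c : odd c ≡ true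
  odd-c = trans (sym (odd-+-even c (S + L))) (cong odd (sym eq))
  c+8≤11 : c + 8 ≤ 11
  c+8≤11 = ≤-trans (+-monoʳ-≤ c (*-monoʳ-≤ 2 (≤-trans S≥4 (m≤m+n S L)))) (≤-reflexive (sym eq))
  c<5 : c < 5
  c<5 = +-cancelʳ-≤ 8 (suc c) 5 (≤-trans (s≤s c+8≤11) (n≤1+n 12))

-- No tight set at v contains the other ends of four of the six half-edges at v:
-- adding v to it would give an odd cut of size at most 3.
no-tight-set-covers-four : ∀ {G v} {h : Fin 6 → HalfEdge G} {U : Fin (n G) → Bool} →
  FiveOddConnected G → Enumerates G v h → Tight G v U →
  U (otherEnd G (h zero)) ≡ true → U (otherEnd G (h (suc zero))) ≡ true →
  U (otherEnd G (h (suc (suc zero)))) ≡ true → U (otherEnd G (h (suc (suc (suc zero))))) ≡ true → ⊥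
no-tight-set-covers-four {G} {v} {h} {U} oc enum tight-U U₀ U₁ U₂ U₃ =
  <⇒≱ (proj₂ small-odd) (large-if-odd {G} oc (U ∪ ｛ v ｝) (proj₁ small-odd))
  where
  open Tight tight-U
  W = U ∖ ｛ v ｝
  o : Fin 6 → Fin (n G)
  o i = otherEnd G (h i)
  S = ∑[ i < 6 ] 𝟙 (W (o i))
  balance : 5 + 6 ≡ cutSize G (U ∪ ｛ v ｝) + 2 * (S + edgesWith G (loopAt v))
  balance = begin
    5 + 6
      ≡⟨ cong₂ _+_ (trans (sym cut-five) (cut-cong G (λ z → sym (∖-avoided {U = U} {v} avoids z)))) (sym (enumeration-count enum (λ _ → true))) ⟩
    cutSize G W + halfEdgesWith G (λ x → at G v x ∧ true)
      ≡⟨ move-vertex G v U ⟩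
    cutSize G (U ∪ ｛ v ｝) + 2 * (halfEdgesWith G (λ x → at G v x ∧ W (otherEnd G x)) + edgesWith G (loopAt v))
      ≡⟨ cong (λ z → cutSize G (U ∪ ｛ v ｝) + 2 * (z + edgesWith G (loopAt v))) (enumeration-count enum (λ x → W (otherEnd G x))) ⟩
    cutSize G (U ∪ ｛ v ｝) + 2 * (S + edgesWith G (loopAt v))
      ∎
  in-W : ∀ {z} → U z ≡ true → W z ≡ true
  in-W {z} Uz = trans (∖-avoided {U = U} {v} avoids z) Uz
  small-odd : odd (cutSize G (U ∪ ｛ v ｝)) ≡ true × cutSize G (U ∪ ｛ v ｝) < 5
  small-odd = cover-arith _ S _ balance (four-ones _ (in-W U₀) (in-W U₁) (in-W U₂) (in-W U₃))

kept : ∀ {m} → Fin m → Fin m → Fin m → Bool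
kept e₁ e₂ k = not ⌊ k ≟ e₁ ⌋ ∧ not ⌊ k ≟ e₂ ⌋

keptCut : (G : Graph) → HalfEdge G → HalfEdge G → (Fin (n G) → Bool) → ℕ
keptCut G h₁ h₂ A = ∑[ k < length (edges G) ] 𝟙 (kept (proj₁ h₁) (proj₁ h₂) k ∧ crosses A (edge G k))

old : ∀ {N} → (Fin (suc N) → Bool) → Fin N → Bool
old A′ z = A′ (inject₁ z)

split-cut : (G : Graph) (h₁ h₂ : HalfEdge G) (A′ : Fin (suc (n G)) → Bool) →
  cutSize (split G h₁ h₂) A′ ≡ keptCut G h₁ h₂ (old A′) +
    (𝟙 (A′ (fromℕ (n G)) xor old A′ (otherEnd G h₁)) + 𝟙 (A′ (fromℕ (n G)) xor old A′ (otherEnd G h₂)))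
split-cut G (e₁ , b₁) (e₂ , b₂) A′ =
  trans (count-++ (crosses A′) (map lift (map (edge G) indices)) (new (e₁ , b₁) ∷ new (e₂ , b₂) ∷ []))
        (cong₂ _+_ kept-part new-part)
  where
  lift : Fin (n G) × Fin (n G) → Fin (suc (n G)) × Fin (suc (n G))
  lift (x , y) = inject₁ x , inject₁ y
  indices = filterᵇ (kept e₁ e₂) (allFin (length (edges G)))
  new : HalfEdge G → Fin (suc (n G)) × Fin (suc (n G))
  new h = fromℕ (n G) , inject₁ (otherEnd G h)
  kept-part : count (crosses A′) (map lift (map (edge G) indices)) ≡ keptCut G (e₁ , b₁) (e₂ , b₂) (old A′)
  kept-part = begin
    count (crosses A′) (map lift (map (edge G) indices))   ≡⟨ count-map (crosses A′) lift (map (edge G) indices) ⟩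
    count (crosses (old A′)) (map (edge G) indices)        ≡⟨ count-map (crosses (old A′)) (edge G) indices ⟩
    count (λ k → crosses (old A′) (edge G k)) indices      ≡⟨ count-filter _ (kept e₁ e₂) (allFin _) ⟩
    count (λ k → kept e₁ e₂ k ∧ crosses (old A′) (edge G k)) (allFin _)
      ≡⟨ count-tabulate (λ k → kept e₁ e₂ k ∧ crosses (old A′) (edge G k)) (λ k → k) ⟩
    keptCut G (e₁ , b₁) (e₂ , b₂) (old A′)                 ∎
  new-part : ∀ {a b} → count (crosses A′) (a ∷ b ∷ []) ≡ 𝟙 (crosses A′ a) + 𝟙 (crosses A′ b)
  new-part {a} {b} = begin
    count (crosses A′) (a ∷ b ∷ [])          ≡⟨ count-∷ (crosses A′) a (b ∷ []) ⟩
    𝟙 (crosses A′ a) + count (crosses A′) (b ∷ []) ≡⟨ cong (𝟙 (crosses A′ a) +_) (count-∷ (crosses A′) b []) ⟩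
    𝟙 (crosses A′ a) + (𝟙 (crosses A′ b) + 0) ≡⟨ cong (𝟙 (crosses A′ a) +_) (+-identityʳ _) ⟩
    𝟙 (crosses A′ a) + 𝟙 (crosses A′ b)      ∎

∑-removed-two : ∀ {m} {e₁ e₂ : Fin m} (b : Fin m → Bool) → e₁ ≢ e₂ →
  ∑[ k < m ] 𝟙 (not (kept e₁ e₂ k) ∧ b k) ≡ 𝟙 (b e₁) + 𝟙 (b e₂)
∑-removed-two {m} {e₁} {e₂} b e₁≢e₂ = begin
  ∑[ k < m ] 𝟙 (not (kept e₁ e₂ k) ∧ b k)                         ≡⟨ sum-cong-≗ two-points ⟩
  ∑[ k < m ] (𝟙 (does (k ≟ e₁) ∧ b k) + 𝟙 (does (k ≟ e₂) ∧ b k))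
    ≡⟨ ∑-distrib-+ (λ k → 𝟙 (does (k ≟ e₁) ∧ b k)) (λ k → 𝟙 (does (k ≟ e₂) ∧ b k)) ⟩
  ∑[ k < m ] 𝟙 (does (k ≟ e₁) ∧ b k) + ∑[ k < m ] 𝟙 (does (k ≟ e₂) ∧ b k)
    ≡⟨ cong₂ _+_ (∑-point e₁ b) (∑-point e₂ b) ⟩
  𝟙 (b e₁) + 𝟙 (b e₂)                                             ∎
  where
  two-points : ∀ k → 𝟙 (not (kept e₁ e₂ k) ∧ b k) ≡ 𝟙 (does (k ≟ e₁) ∧ b k) + 𝟙 (does (k ≟ e₂) ∧ b k)
  two-points k with k ≟ e₁ | k ≟ e₂
  ... | yes refl | yes refl = ⊥-elim (e₁≢e₂ refl)
  ... | yes _    | no _     = sym (+-identityʳ _)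
  ... | no _     | yes _    = refl
  ... | no _     | no _     = refl

∑-removed-one : ∀ {m} (e : Fin m) (b : Fin m → Bool) → ∑[ k < m ] 𝟙 (not (kept e e k) ∧ b k) ≡ 𝟙 (b e)
∑-removed-one {m} e b = trans (sum-cong-≗ one-point) (∑-point e b)
  where
  one-point : ∀ k → 𝟙 (not (kept e e k) ∧ b k) ≡ 𝟙 (does (k ≟ e) ∧ b k)
  one-point k with k ≟ e
  ... | yes _ = refl
  ... | no _  = refl

crosses-at : (G : Graph) {v : Fin (n G)} (A : Fin (n G) → Bool) (h : HalfEdge G) → endpoint G h ≡ v →
  crosses A (edge G (proj₁ h)) ≡ A v xor A (otherEnd G h)
crosses-at G A h refl = at-half-edge G (crosses A) (crosses-sym A) h

other-end-of-same-edge : (G : Graph) (h₁ h₂ : HalfEdge G) → proj₁ h₁ ≡ proj₁ h₂ → h₁ ≢ h₂ →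
  otherEnd G h₁ ≡ endpoint G h₂
other-end-of-same-edge G (e , false) (.e , false) refl h₁≢h₂ = ⊥-elim (h₁≢h₂ refl)
other-end-of-same-edge G (e , false) (.e , true)  refl h₁≢h₂ = refl
other-end-of-same-edge G (e , true)  (.e , false) refl h₁≢h₂ = refl
other-end-of-same-edge G (e , true)  (.e , true)  refl h₁≢h₂ = ⊥-elim (h₁≢h₂ refl)

-- The cut of A in G: the kept edges, and the removed edges vv₁ and vv₂. If these are the
-- two ends of one loop at v, that loop is counted once but both terms on the right vanish.
cut-around-v : (G : Graph) (v : Fin (n G)) (h₁ h₂ : HalfEdge G) → h₁ ≢ h₂ →
  endpoint G h₁ ≡ v → endpoint G h₂ ≡ v → (A : Fin (n G) → Bool) →
  cutSize G A ≡ keptCut G h₁ h₂ A + (𝟙 (A v xor A (otherEnd G h₁)) + 𝟙 (A v xor A (otherEnd G h₂)))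
cut-around-v G v h₁@(e₁ , b₁) h₂@(e₂ , b₂) h₁≢h₂ h₁-at-v h₂-at-v A = begin
  cutSize G A                                                   ≡⟨ cut-as-sum G A ⟩
  ∑[ k < m ] 𝟙 (P k)                                            ≡⟨ sum-cong-≗ (λ k → kept-or-removed (kept e₁ e₂ k) (P k)) ⟩
  ∑[ k < m ] (𝟙 (kept e₁ e₂ k ∧ P k) + 𝟙 (not (kept e₁ e₂ k) ∧ P k))
    ≡⟨ ∑-distrib-+ (λ k → 𝟙 (kept e₁ e₂ k ∧ P k)) (λ k → 𝟙 (not (kept e₁ e₂ k) ∧ P k)) ⟩
  keptCut G h₁ h₂ A + ∑[ k < m ] 𝟙 (not (kept e₁ e₂ k) ∧ P k)   ≡⟨ cong (keptCut G h₁ h₂ A +_) (removed (e₁ ≟ e₂)) ⟩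
  keptCut G h₁ h₂ A + (𝟙 (A v xor A o₁) + 𝟙 (A v xor A o₂))      ∎
  where
  m = length (edges G)
  o₁ = otherEnd G h₁
  o₂ = otherEnd G h₂
  P : Fin m → Bool
  P k = crosses A (edge G k)
  kept-or-removed : ∀ c b → 𝟙 b ≡ 𝟙 (c ∧ b) + 𝟙 (not c ∧ b)
  kept-or-removed true  b = sym (+-identityʳ (𝟙 b))
  kept-or-removed false b = refl
  removed : Dec (e₁ ≡ e₂) → ∑[ k < m ] 𝟙 (not (kept e₁ e₂ k) ∧ P k) ≡ 𝟙 (A v xor A o₁) + 𝟙 (A v xor A o₂)
  removed (no e₁≢e₂) = trans (∑-removed-two P e₁≢e₂)
    (cong₂ (λ p q → 𝟙 p + 𝟙 q) (crosses-at G A h₁ h₁-at-v) (crosses-at G A h₂ h₂-at-v))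
  -- a loop at v: o₂ = v, so the second term vanishes
  removed (yes refl) = begin
    ∑[ k < m ] 𝟙 (not (kept e₁ e₁ k) ∧ P k)   ≡⟨ ∑-removed-one e₁ P ⟩
    𝟙 (P e₁)                                  ≡⟨ cong 𝟙 (crosses-at G A h₁ h₁-at-v) ⟩
    𝟙 (A v xor A o₁)                          ≡⟨ +-identityʳ _ ⟨
    𝟙 (A v xor A o₁) + 0                      ≡⟨ cong (λ z → 𝟙 (A v xor A o₁) + 𝟙 z) (separates-nothing o₂-is-v) ⟨
    𝟙 (A v xor A o₁) + 𝟙 (A v xor A o₂)       ∎
    where
    o₂-is-v : o₂ ≡ v
    o₂-is-v = trans (other-end-of-same-edge G h₂ h₁ refl (λ h₂≡h₁ → h₁≢h₂ (sym h₂≡h₁))) h₁-at-v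
    separates-nothing : ∀ {z} → z ≡ v → A v xor A z ≡ false
    separates-nothing refl = Bool.xor-same (A v)

-- Here s < 5 is an odd cut of the split graph and c
-- the cut of G on the same old vertices; the balance compares the edges at v (value a)
-- with those at the new vertex (value w), whose other ends have values x and y.
-- Only if x = y = not a and w = x can the cut of G exceed s, and then c = s + 2 = 5.
split-arith : ∀ {s c} → odd s ≡ true → s < 5 → LargeIfOdd c → ∀ a x y w →
  s + (𝟙 (a xor x) + 𝟙 (a xor y)) ≡ c + (𝟙 (w xor x) + 𝟙 (w xor y)) → x ≡ not a × y ≡ not a × c ≡ 5
split-arith {s} {c} odd-s s<5 large-c = balance-cases
  where
  unchanged : ∀ {k} → s + k ≡ c + k → ⊥
  unchanged {k} eq = <⇒≱ s<5 (subst (5 ≤_) (sym s≡c) (large-c (trans (cong odd (sym s≡c)) odd-s)))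
    where
    s≡c : s ≡ c
    s≡c = +-cancelʳ-≡ k s c eq
  shrinks : s + 0 ≡ c + 2 → ⊥
  shrinks eq = <⇒≱ s<5 (≤-trans (large-c odd-c) (≤-trans (m≤m+n c 2) (≤-reflexive (sym s≡c+2))))
    where
    s≡c+2 : s ≡ c + 2
    s≡c+2 = trans (sym (+-identityʳ s)) eq
    odd-c : odd c ≡ true
    odd-c = trans (sym (odd-+-even c 1)) (trans (cong odd (sym s≡c+2)) odd-s)
  grows : s + 2 ≡ c + 0 → c ≡ 5
  grows eq = ≤-antisym (≤-pred (≤∧≢⇒< c≤6 c≢6)) (large-c odd-c)
    where
    c≡s+2 : c ≡ s + 2
    c≡s+2 = trans (sym (+-identityʳ c)) (sym eq)
    odd-c : odd c ≡ true
    odd-c = trans (cong odd c≡s+2) (trans (odd-+-even s 1) odd-s)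
    c≤6 : c ≤ 6
    c≤6 = ≤-trans (≤-reflexive c≡s+2) (+-monoˡ-≤ 2 (≤-pred s<5))
    c≢6 : c ≢ 6
    c≢6 c≡6 with () ← trans (sym odd-c) (cong odd c≡6)
  mixed : ∀ w → 𝟙 (w xor true) + 𝟙 (w xor false) ≡ 1
  mixed true  = refl
  mixed false = refl
  mixed′ : ∀ w → 𝟙 (w xor false) + 𝟙 (w xor true) ≡ 1
  mixed′ true  = refl
  mixed′ false = refl
  balance-cases : ∀ a x y w →
    s + (𝟙 (a xor x) + 𝟙 (a xor y)) ≡ c + (𝟙 (w xor x) + 𝟙 (w xor y)) → x ≡ not a × y ≡ not a × c ≡ 5
  balance-cases true  false false false eq = refl , refl , grows eq
  balance-cases false true  true  true  eq = refl , refl , grows eq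
  balance-cases true  true  true  false eq = ⊥-elim (shrinks eq)
  balance-cases false false false true  eq = ⊥-elim (shrinks eq)
  balance-cases true  true  true  true  eq = ⊥-elim (unchanged eq)
  balance-cases true  true  false w     eq = ⊥-elim (unchanged {1} (trans eq (cong (c +_) (mixed w))))
  balance-cases true  false true  w     eq = ⊥-elim (unchanged {1} (trans eq (cong (c +_) (mixed′ w))))
  balance-cases true  false false true  eq = ⊥-elim (unchanged eq)
  balance-cases false true  true  false eq = ⊥-elim (unchanged eq)
  balance-cases false true  false w     eq = ⊥-elim (unchanged {1} (trans eq (cong (c +_) (mixed w))))
  balance-cases false false true  w     eq = ⊥-elim (unchanged {1} (trans eq (cong (c +_) (mixed′ w))))
  balance-cases false false false false eq = ⊥-elim (unchanged eq)

SmallOddCut : (H : Graph) → (Fin (n H) → Bool) → Set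
SmallOddCut H A = odd (cutSize H A) ≡ true × cutSize H A < 5

TightThrough : (G : Graph) → Fin (n G) → Fin (n G) → Fin (n G) → Set
TightThrough G v a b = Σ[ X ∈ (Fin (n G) → Bool) ] (Tight G v X × X a ≡ true × X b ≡ true)

split-balance : (G : Graph) (v : Fin (n G)) (h₁ h₂ : HalfEdge G) → h₁ ≢ h₂ →
  endpoint G h₁ ≡ v → endpoint G h₂ ≡ v → (A′ : Fin (suc (n G)) → Bool) →
  let A = old A′ ; w = A′ (fromℕ (n G)) ; o₁ = otherEnd G h₁ ; o₂ = otherEnd G h₂ in
  cutSize (split G h₁ h₂) A′ + (𝟙 (A v xor A o₁) + 𝟙 (A v xor A o₂)) ≡ cutSize G A + (𝟙 (w xor A o₁) + 𝟙 (w xor A o₂))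
split-balance G v h₁ h₂ h₁≢h₂ h₁-at-v h₂-at-v A′ = begin
  cutSize (split G h₁ h₂) A′ + at-v   ≡⟨ cong (_+ at-v) (split-cut G h₁ h₂ A′) ⟩
  keptCut G h₁ h₂ A + at-w + at-v     ≡⟨ xy∙z≈xz∙y (keptCut G h₁ h₂ A) at-w at-v ⟩
  keptCut G h₁ h₂ A + at-v + at-w     ≡⟨ cong (_+ at-w) (cut-around-v G v h₁ h₂ h₁≢h₂ h₁-at-v h₂-at-v A) ⟨
  cutSize G A + at-w                  ∎
  where
  A = old A′
  at-v = 𝟙 (A v xor A (otherEnd G h₁)) + 𝟙 (A v xor A (otherEnd G h₂))
  at-w = 𝟙 (A′ (fromℕ (n G)) xor A (otherEnd G h₁)) + 𝟙 (A′ (fromℕ (n G)) xor A (otherEnd G h₂))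

-- A small odd cut of the splitting G.v₁vv₂ yields a tight set through v₁ and v₂: its old
-- part, or the complement of that if it contains v.
split-obstruction : ∀ {G : Graph} {v : Fin (n G)} {h₁ h₂ : HalfEdge G} → FiveOddConnected G → h₁ ≢ h₂ →
  endpoint G h₁ ≡ v → endpoint G h₂ ≡ v → (A′ : Fin (suc (n G)) → Bool) → SmallOddCut (split G h₁ h₂) A′ →
  TightThrough G v (otherEnd G h₁) (otherEnd G h₂)
split-obstruction {G} {v} {h₁} {h₂} oc h₁≢h₂ h₁-at-v h₂-at-v A′ (odd-s , s<5)
  with split-arith odd-s s<5 (large-if-odd {G} oc (old A′)) (old A′ v) (old A′ (otherEnd G h₁)) (old A′ (otherEnd G h₂))
         (A′ (fromℕ (n G))) (split-balance G v h₁ h₂ h₁≢h₂ h₁-at-v h₂-at-v A′)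
... | o₁-out , o₂-out , cut-five = orient (old A′ v) refl
  where
  A = old A′
  orient : ∀ b → A v ≡ b → TightThrough G v (otherEnd G h₁) (otherEnd G h₂)
  orient false Av = A , record { cut-five = cut-five ; avoids = Av } ,
    trans o₁-out (cong not Av) , trans o₂-out (cong not Av)
  orient true  Av = ∁ A , record { cut-five = trans (cut-∁ G A) cut-five ; avoids = cong not Av } ,
    cong not (trans o₁-out (cong not Av)) , cong not (trans o₂-out (cong not Av))

-- 5-odd-connectivity is decidable: there are only finitely many vertex sets.
five-odd-connected? : (H : Graph) → FiveOddConnected H ⊎ ∃ (SmallOddCut H)
five-odd-connected? H with anySubset? (λ S → small-odd? (lookupᵥ S))
  where
  small-odd? : ∀ A → Dec (SmallOddCut H A)
  small-odd? A = (odd (cutSize H A) Bool.≟ true) ×-dec (cutSize H A <? 5)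
... | yes (S , small-odd) = inj₂ (lookupᵥ S , small-odd)
... | no none = inj₁ λ A odd-A → ≮⇒≥ λ A<5 → none (tabulateᵥ A ,
  subst (λ c → odd c ≡ true × c < 5) (cut-cong H (λ z → sym (lookup∘tabulate A z)))
        (%2≡1⇒odd (cutSize H A) odd-A , A<5))

∪-introˡ : ∀ {V : Set} {X Y : V → Bool} {z : V} → X z ≡ true → (X ∪ Y) z ≡ true
∪-introˡ {Y = Y} {z} Xz = cong (_∨ Y z) Xz

∪-introʳ : ∀ {V : Set} {X Y : V → Bool} {z : V} → Y z ≡ true → (X ∪ Y) z ≡ true
∪-introʳ {X = X} {z = z} Yz = trans (cong (X z ∨_) Yz) (Bool.∨-zeroʳ (X z))

-- The splittings at (v₁,v₂), (v₂,v₃), (v₃,v₄) cannot all fail: their tight sets X, Y, Z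
-- uncross at v₂ and then at v₃ into a tight set through v₁, …, v₄.
splittings-cannot-all-fail : ∀ {G : Graph} {v : Fin (n G)} {h : Fin 6 → HalfEdge G} →
  FiveOddConnected G → Enumerates G v h →
  ∃ (SmallOddCut (split G (h zero) (h (suc zero)))) →
  ∃ (SmallOddCut (split G (h (suc zero)) (h (suc (suc zero))))) →
  ∃ (SmallOddCut (split G (h (suc (suc zero))) (h (suc (suc (suc zero)))))) → ⊥
splittings-cannot-all-fail {G} {v} {h} oc enum (A₁ , small₁) (A₂ , small₂) (A₃ , small₃)
  with obstruction (λ ()) A₁ small₁ | obstruction (λ ()) A₂ small₂ | obstruction (λ ()) A₃ small₃
  where
  open Enumerates enum
  obstruction : ∀ {i j} → i ≢ j → (A′ : Fin (suc (n G)) → Bool) → SmallOddCut (split G (h i) (h j)) A′ →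
    TightThrough G v (otherEnd G (h i)) (otherEnd G (h j))
  obstruction {i} {j} i≢j = split-obstruction oc (λ hi≡hj → i≢j (injective hi≡hj)) (at-v i) (at-v j)
... | X , tight-X , X₀ , X₁ | Y , tight-Y , Y₁ , Y₂ | Z , tight-Z , Z₂ , Z₃ =
  no-tight-set-covers-four oc enum tight-XYZ
    (∪-introˡ {X = X ∪ Y} {Z} (∪-introˡ {X = X} {Y} X₀)) (∪-introˡ {X = X ∪ Y} {Z} (∪-introˡ {X = X} {Y} X₁))
    (∪-introʳ {X = X ∪ Y} {Z} Z₂) (∪-introʳ {X = X ∪ Y} {Z} Z₃)
  where
  open Enumerates enum
  tight-XY : Tight G v (X ∪ Y)
  tight-XY = uncross oc (h (suc zero)) (at-v (suc zero)) tight-X tight-Y X₁ Y₁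
  tight-XYZ : Tight G v ((X ∪ Y) ∪ Z)
  tight-XYZ = uncross oc (h (suc (suc zero))) (at-v (suc (suc zero))) tight-XY tight-Z (∪-introʳ {X = X} {Y} Y₂) Z₂

lemma6 : (G : Graph) (v : Fin (n G)) (h : Fin 6 → HalfEdge G)
         → Injective _≡_ _≡_ h
         → (∀ i → endpoint G (h i) ≡ v)
         → (∀ x → endpoint G x ≡ v → ∃ λ i → h i ≡ x)
         → FiveOddConnected G
         → FiveOddConnected (split G (h zero) (h (suc zero)))
           ⊎ FiveOddConnected (split G (h (suc zero)) (h (suc (suc zero))))
           ⊎ FiveOddConnected (split G (h (suc (suc zero))) (h (suc (suc (suc zero)))))
lemma6 G v h injective at-v complete oc
  with five-odd-connected? (split G (h zero) (h (suc zero)))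
     | five-odd-connected? (split G (h (suc zero)) (h (suc (suc zero))))
     | five-odd-connected? (split G (h (suc (suc zero))) (h (suc (suc (suc zero)))))
... | inj₁ first  | _           | _          = inj₁ first
... | inj₂ _      | inj₁ second | _          = inj₂ (inj₁ second)
... | inj₂ _      | inj₂ _      | inj₁ third = inj₂ (inj₂ third)
... | inj₂ fail₁  | inj₂ fail₂  | inj₂ fail₃ =
  ⊥-elim (splittings-cannot-all-fail oc (record { injective = injective ; at-v = at-v ; complete = complete }) fail₁ fail₂ fail₃)
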